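{- Let $f:\{0,1\}^n\to\{0,1\}$ be of the form $f(x)=\prod_{j\in[k]}f_j(x_j)$, where $x_1,\dots,x_k$ are the restrictions of $x$ to the blocks of a partition of the coordinates $[n]$, and each $f_j$ is computed by a width-2 regular ordered branching program. Then $L_p(f)\le 2kp\cdot\mathbb{E}_U[f(U)]$ for every $p\in[0,1/k]$.
   Context: $U$ is uniform on $\{0,1\}^n$. For $g:\{0,1\}^m\to\mathbb{R}$, $\widehat g[s]=\mathbb{E}_U[g(U)(-1)^{\sum_{i\in s}U_i}]$ and $L_p(g)=\sum_{s\ne\emptyset}p^{|s|}|\widehat g[s]|$. A width-2 ordered branching program has vertex layers $V_0,\dots,V_m$ with $|V_i|\le2$ and transition maps $T_i:V_{i-1}\times\{0,1\}\to V_i$; it computes $g$ if, starting from a fixed $u_0\in V_0$ and following $T_i(\cdot,y_i)$, the final vertex lies in a fixed $S\subseteq V_m$ iff $g(y)=1$. It is regular if every layer $i$ has $|V_{i-1}|=|V_i|$ and the averaged transition matrix $\mathbb{E}_{b}[T_i(\cdot,b)]$ (over a uniform bit $b$) is doubly stochastic. -}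

module Defs where

open import Data.Bool using (Bool; true; false; if_then_else_)
open import Data.Nat as ℕ using (ℕ; zero; suc; _≤_)
open import Data.Fin using (Fin; zero; suc; inject₁; fromℕ)
open import Data.Fin.Properties using (_≟_)
open import Data.List using (List; []; _∷_; map; _++_; foldr)
open import Data.Product using (Σ; _×_; _,_)
open import Data.Integer using (+_)
open import Function.Bundles using (Bijection)
open import Relation.Binary.PropositionalEquality using (_≡_; setoid)
open import Relation.Nullary using (does)
open import Data.Rational as ℚ using (ℚ; 0ℚ; 1ℚ; _+_; _*_; _/_; ∣_∣; -_)

-- Bit strings {0,1}^n, as functions Fin n → Bool (true = 1).
BitStr : ℕ → Set
BitStr n = Fin n → Bool

allStrs : (n : ℕ) → List (BitStr n)
allStrs zero = (λ ()) ∷ []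
allStrs (suc n) =
  map (λ x → λ { zero → false ; (suc i) → x i }) (allStrs n) ++
  map (λ x → λ { zero → true ; (suc i) → x i }) (allStrs n)

sumL : List ℚ → ℚ
sumL = foldr _+_ 0ℚ

sumFin : (n : ℕ) → (Fin n → ℚ) → ℚ
sumFin zero f = 0ℚ
sumFin (suc n) f = f zero + sumFin n (λ i → f (suc i))

prodFin : (n : ℕ) → (Fin n → ℚ) → ℚ
prodFin zero f = 1ℚ
prodFin (suc n) f = f zero * prodFin n (λ i → f (suc i))

_^_ : ℚ → ℕ → ℚ
p ^ zero = 1ℚ
p ^ suc n = p * (p ^ n)

E : (n : ℕ) → (BitStr n → ℚ) → ℚ
E n g = sumL (map g (allStrs n)) * (((+ 1) / 2) ^ n)

b2q : Bool → ℚ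
b2q true = 1ℚ
b2q false = 0ℚ

-- |s| for s ⊆ [n] given as its indicator.
card : {n : ℕ} → BitStr n → ℕ
card {zero} s = 0
card {suc n} s = (if s zero then 1 else 0) ℕ.+ card (λ i → s (suc i))

chi : {n : ℕ} → BitStr n → BitStr n → ℚ
chi {zero} s u = 1ℚ
chi {suc n} s u =
  (if (s zero Data.Bool.∧ u zero) then - 1ℚ else 1ℚ) * chi (λ i → s (suc i)) (λ i → u (suc i))

fourier : {n : ℕ} → (BitStr n → ℚ) → BitStr n → ℚ
fourier {n} g s = E n (λ u → g u * chi s u)

isEmptySet : {n : ℕ} → BitStr n → Bool
isEmptySet {zero} s = true
isEmptySet {suc n} s = if s zero then false else isEmptySet (λ i → s (suc i))

Lp : {n : ℕ} → ℚ → (BitStr n → ℚ) → ℚ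
Lp {n} p g = sumL (map (λ s → if isEmptySet s then 0ℚ else (p ^ card s) * ∣ fourier g s ∣) (allStrs n))

runBP : (m : ℕ) (w : Fin (suc m) → ℕ)
        (tr : (t : Fin m) → Fin (w (inject₁ t)) → Bool → Fin (w (suc t))) →
        Fin (w zero) → BitStr m → Fin (w (fromℕ m))
runBP zero w tr s y = s
runBP (suc m) w tr s y =
  runBP m (λ i → w (suc i)) (λ t → tr (suc t)) (tr zero s (y zero)) (λ i → y (suc i))

-- Width-2 ordered branching program of length m.
-- Layer i (i = 0..m) has vertex set Fin (width i); transition t : Fin m goes from
-- layer (inject₁ t) to layer (suc t) and reads bit y_t.
record BP (m : ℕ) : Set where
  field
    width : Fin (suc m) → ℕ
    width≤2 : ∀ i → width i ≤ 2
    trans : (t : Fin m) → Fin (width (inject₁ t)) → Bool → Fin (width (suc t))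
    start : Fin (width zero)
    accept : Fin (width (fromℕ m)) → Bool   -- indicator of S ⊆ V_m

  output : BitStr m → Bool
  output y = accept (runBP m width trans start y)

Computes : {m : ℕ} → BP m → (BitStr m → Bool) → Set
Computes P g = ∀ y → BP.output P y ≡ g y

avgEntry : {m : ℕ} (P : BP m) (t : Fin m) →
           Fin (BP.width P (inject₁ t)) → Fin (BP.width P (suc t)) → ℚ
avgEntry P t u v =
  (b2q (does (BP.trans P t u false ≟ v)) + b2q (does (BP.trans P t u true ≟ v))) * ((+ 1) / 2)

Regular : {m : ℕ} → BP m → Set
Regular {m} P = ∀ (t : Fin m) →
    (BP.width P (inject₁ t) ≡ BP.width P (suc t))
  × (∀ u → sumFin (BP.width P (suc t)) (λ v → avgEntry P t u v) ≡ 1ℚ)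
  × (∀ v → sumFin (BP.width P (inject₁ t)) (λ u → avgEntry P t u v) ≡ 1ℚ)

-- Partition of [n] into k nonempty blocks; block j is listed (in some order) by
-- an injection σ j : Fin (size j) → Fin n, and jointly the blocks cover [n] exactly once.
record Partition (n k : ℕ) : Set where
  field
    size : Fin k → ℕ
    nonempty : ∀ j → 1 ≤ size j
    σ : (j : Fin k) → Fin (size j) → Fin n
    bij : Bijection (setoid (Σ (Fin k) λ j → Fin (size j))) (setoid (Fin n))
    bij-is-σ : ∀ j t → Bijection.to bij (j , t) ≡ σ j t

  restrict : (j : Fin k) → BitStr n → BitStr (size j)
  restrict j x t = x (σ j t)

blockProduct : {n k : ℕ} (π : Partition n k) →
               ((j : Fin k) → BitStr (Partition.size π j) → Bool) → BitStr n → ℚ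
blockProduct {n} {k} π fs x = prodFin k (λ j → b2q (fs j (Partition.restrict π j x)))

-- A regular width-2 program computes an affine function y ↦ c ⊕ T · y over GF(2): each layer moves the
-- state bit affinely, because a doubly stochastic column forces the fourth transition. So every factor
-- f_j is a constant or ½ ∓ ½ χ_{T_j} with T_j ≠ ∅, and f = Π_j (α_j + β_j χ_{S_j}) with pairwise
-- disjoint S_j ⊆ [n]. Writing g (b ∷ x) = avg g x + (-1)^b halfDiff g x, the coefficients ĝ[0s] and
-- ĝ[1s] are those of avg g and halfDiff g at s. As a coordinate lies in at most one S_j, both halves are
-- again such products, so induction on n gives Σ_s p^{|s|} |f̂[s]| ≤ Π_j (|α_j| + |β_j| p^{|S_j|}) and
-- E f = Π_j α_j. Each factor is at most (1 + p) α_j, hence L_p(f) ≤ ((1 + p)^k − 1) E f, and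
-- (1 + p)^k ≤ 1 + kp + (kp)² ≤ 1 + 2kp when kp ≤ 1.

{-# OPTIONS --safe #-}
module Submission where

open import Defs
open import Data.Nat using (ℕ; NonZero)
open import Data.Fin using (Fin)
open import Data.Bool using (Bool)
open import Data.Product using (Σ; _×_)
open import Data.Integer using (+_)
open import Data.Rational using (ℚ; 0ℚ; _≤_; _*_; _/_)

open import Data.Nat as ℕ using (zero; suc; z≤n; s≤s)
import Data.Nat.Properties as ℕ
import Data.Integer as ℤ
import Data.Integer.Properties as ℤ
open import Data.Fin using (zero; suc)
open import Data.Fin.Properties using (_≟_; suc-injective; any?)
open import Data.Bool using (true; false; if_then_else_; _∧_; _xor_)
open import Data.Bool.Properties using (¬-not; not-¬; ∧-zeroʳ; xor-assoc; xor-identityʳ) renaming (_≟_ to _≟ᵇ_)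
open import Data.Bool.Solver using (module xor-∧-Solver)
open import Data.Product using (∃; ∃₂; _,_; proj₁; proj₂)
open import Data.Sum as Sum using (_⊎_; inj₁; inj₂)
open import Data.Empty using (⊥-elim; ⊥-elim-irr)
open import Data.List as List using (List; map; _++_)
open import Data.List.Properties using (map-cong; map-∘)
open import Data.Vec.Functional using (_∷_; tail)
open import Data.Vec.Functional.Properties using (∷-cong)
open import Data.Rational using (1ℚ; _+_; _-_; -_; ∣_∣; nonNegative; fromℚᵘ)
open import Data.Rational.Properties
  using ( module ≤-Reasoning; ≤-refl; ≤-reflexive; ≤-trans; nonNegative⁻¹; normalize-nonNeg
        ; +-identityˡ; +-identityʳ; +-assoc; +-inverseʳ; +-mono-≤; +-monoˡ-≤; +-monoʳ-≤
        ; *-zeroˡ; *-zeroʳ; *-identityˡ; *-identityʳ; *-assoc; *-distribˡ-+; *-distribʳ-+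
        ; *-monoˡ-≤-nonNeg; *-monoʳ-≤-nonNeg; 0≤∣p∣; 0≤p⇒∣p∣≡p; ∣p*q∣≡∣p∣*∣q∣; ∣p+q∣≤∣p∣+∣q∣
        ; toℚᵘ-injective; toℚᵘ-fromℚᵘ; fromℚᵘ-cong; toℚᵘ-homo-+; toℚᵘ-homo-* )
open import Data.Rational.Solver using (module +-*-Solver)
open import Data.Rational.Unnormalised as ℚᵘ using (mkℚᵘ; *≡*)
import Data.Rational.Unnormalised.Properties as ℚᵘ
open import Function using (_∘_)
open import Function.Bundles using (Bijection)
open import Function.Definitions using (Congruent; Injective)
open import Relation.Binary.PropositionalEquality
open import Relation.Nullary using (¬_; Dec; yes; no; does; contradiction)

open +-*-Solver
open xor-∧-Solver using ()
  renaming (solve to solveᵇ; _:+_ to infixr 6 _:⊕_; _:*_ to infixr 7 _:∧_; _:=_ to infix 4 _:=ᵇ_; con to conᵇ)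

private
  variable
    m n k : ℕ

½ : ℚ
½ = + 1 / 2

*-monoˡ-≤-0≤ : {r x y : ℚ} → 0ℚ ≤ r → x ≤ y → r * x ≤ r * y
*-monoˡ-≤-0≤ {r} 0≤r = *-monoˡ-≤-nonNeg r {{nonNegative 0≤r}}

*-monoʳ-≤-0≤ : {r x y : ℚ} → 0ℚ ≤ r → x ≤ y → x * r ≤ y * r
*-monoʳ-≤-0≤ {r} 0≤r = *-monoʳ-≤-nonNeg r {{nonNegative 0≤r}}

*-mono-≤-0≤ : {x x' y y' : ℚ} → 0ℚ ≤ x → 0ℚ ≤ y' → x ≤ x' → y ≤ y' → x * y ≤ x' * y'
*-mono-≤-0≤ 0≤x 0≤y' x≤x' y≤y' = ≤-trans (*-monoˡ-≤-0≤ 0≤x y≤y') (*-monoʳ-≤-0≤ 0≤y' x≤x')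

0≤* : {x y : ℚ} → 0ℚ ≤ x → 0ℚ ≤ y → 0ℚ ≤ x * y
0≤* {x} 0≤x 0≤y = ≤-trans (≤-reflexive (sym (*-zeroʳ x))) (*-monoˡ-≤-0≤ 0≤x 0≤y)

0≤+ : {x y : ℚ} → 0ℚ ≤ x → 0ℚ ≤ y → 0ℚ ≤ x + y
0≤+ = +-mono-≤

0≤^ : {p : ℚ} → 0ℚ ≤ p → ∀ m → 0ℚ ≤ p ^ m
0≤^ 0≤p zero = nonNegative⁻¹ 1ℚ
0≤^ 0≤p (suc m) = 0≤* 0≤p (0≤^ 0≤p m)

p^m≤1 : {p : ℚ} → 0ℚ ≤ p → p ≤ 1ℚ → ∀ m → p ^ m ≤ 1ℚ
p^m≤1 0≤p p≤1 zero = ≤-refl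
p^m≤1 {p} 0≤p p≤1 (suc m) =
  ≤-trans (*-monoˡ-≤-0≤ 0≤p (p^m≤1 0≤p p≤1 m)) (≤-trans (≤-reflexive (*-identityʳ p)) p≤1)

p≤p+q : (p : ℚ) {q : ℚ} → 0ℚ ≤ q → p ≤ p + q
p≤p+q p 0≤q = ≤-trans (≤-reflexive (sym (+-identityʳ p))) (+-monoʳ-≤ p 0≤q)

+-cancelʳ-≤ : {x y e : ℚ} → x + e ≤ y + e → x ≤ y
+-cancelʳ-≤ {x} {y} {e} x+e≤y+e = begin
  x           ≡⟨ solve 2 (λ x e → x := x :+ e :- e) refl x e ⟩
  x + e - e   ≤⟨ +-monoˡ-≤ (- e) x+e≤y+e ⟩
  y + e - e   ≡⟨ solve 2 (λ y e → y :+ e :- e := y) refl y e ⟩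
  y           ∎
  where open ≤-Reasoning

module _ {A : Set} where

  sumL-++ : (h : A → ℚ) (xs ys : List A) → sumL (map h (xs ++ ys)) ≡ sumL (map h xs) + sumL (map h ys)
  sumL-++ h List.[] ys = sym (+-identityˡ _)
  sumL-++ h (x List.∷ xs) ys = trans (cong (λ r → h x + r) (sumL-++ h xs ys)) (sym (+-assoc (h x) _ _))

  sumL-+ : (a b : A → ℚ) (xs : List A) → sumL (map (λ x → a x + b x) xs) ≡ sumL (map a xs) + sumL (map b xs)
  sumL-+ a b List.[] = sym (+-identityˡ 0ℚ)
  sumL-+ a b (x List.∷ xs) = trans (cong (λ r → a x + b x + r) (sumL-+ a b xs))
    (solve 4 (λ a b A B → (a :+ b) :+ (A :+ B) := (a :+ A) :+ (b :+ B)) refl (a x) (b x) _ _)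

  sumL-*ˡ : (c : ℚ) (a : A → ℚ) (xs : List A) → sumL (map (λ x → c * a x) xs) ≡ c * sumL (map a xs)
  sumL-*ˡ c a List.[] = sym (*-zeroʳ c)
  sumL-*ˡ c a (x List.∷ xs) = trans (cong (λ r → c * a x + r) (sumL-*ˡ c a xs)) (sym (*-distribˡ-+ c (a x) _))

  sumL-*ʳ : (c : ℚ) (a : A → ℚ) (xs : List A) → sumL (map (λ x → a x * c) xs) ≡ sumL (map a xs) * c
  sumL-*ʳ c a List.[] = sym (*-zeroˡ c)
  sumL-*ʳ c a (x List.∷ xs) = trans (cong (λ r → a x * c + r) (sumL-*ʳ c a xs)) (sym (*-distribʳ-+ c (a x) _))

prodFin-cong : {a b : Fin k → ℚ} → (∀ j → a j ≡ b j) → prodFin k a ≡ prodFin k b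
prodFin-cong {k = zero} a≡b = refl
prodFin-cong {k = suc k} a≡b = cong₂ _*_ (a≡b zero) (prodFin-cong (a≡b ∘ suc))

prodFin-ones : (a : Fin k → ℚ) → (∀ j → a j ≡ 1ℚ) → prodFin k a ≡ 1ℚ
prodFin-ones {k = zero} a _ = refl
prodFin-ones {k = suc k} a a≡1 = cong₂ _*_ (a≡1 zero) (prodFin-ones (a ∘ suc) (a≡1 ∘ suc))

prodFin-nonNeg : (a : Fin k → ℚ) → (∀ j → 0ℚ ≤ a j) → 0ℚ ≤ prodFin k a
prodFin-nonNeg {k = zero} a _ = nonNegative⁻¹ 1ℚ
prodFin-nonNeg {k = suc k} a 0≤a = 0≤* (0≤a zero) (prodFin-nonNeg (a ∘ suc) (0≤a ∘ suc))

prodFin-mono-≤ : (a b : Fin k → ℚ) → (∀ j → 0ℚ ≤ a j) → (∀ j → a j ≤ b j) → prodFin k a ≤ prodFin k b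
prodFin-mono-≤ {k = zero} a b _ _ = ≤-refl
prodFin-mono-≤ {k = suc k} a b 0≤a a≤b =
  *-mono-≤-0≤ (0≤a zero) (≤-trans (prodFin-nonNeg (a ∘ suc) (0≤a ∘ suc)) tail≤) (a≤b zero) tail≤
  where tail≤ = prodFin-mono-≤ (a ∘ suc) (b ∘ suc) (0≤a ∘ suc) (a≤b ∘ suc)

∣prodFin∣≤prodFin : (a b : Fin k → ℚ) → (∀ j → ∣ a j ∣ ≤ b j) → ∣ prodFin k a ∣ ≤ prodFin k b
∣prodFin∣≤prodFin {k = zero} a b _ = ≤-refl
∣prodFin∣≤prodFin {k = suc k} a b ∣a∣≤b = ≤-trans (≤-reflexive (∣p*q∣≡∣p∣*∣q∣ (a zero) _))
  (*-mono-≤-0≤ (0≤∣p∣ (a zero)) (≤-trans (0≤∣p∣ _) tail≤) (∣a∣≤b zero) tail≤)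
  where tail≤ = ∣prodFin∣≤prodFin (a ∘ suc) (b ∘ suc) (∣a∣≤b ∘ suc)

prodFin-*ˡ : (c : ℚ) (a : Fin k → ℚ) → prodFin k (λ j → c * a j) ≡ c ^ k * prodFin k a
prodFin-*ˡ {k = zero} c a = refl
prodFin-*ˡ {k = suc k} c a = trans (cong (λ r → c * a zero * r) (prodFin-*ˡ c (a ∘ suc)))
  (solve 4 (λ c a₀ cᵏ Π → c :* a₀ :* (cᵏ :* Π) := c :* cᵏ :* (a₀ :* Π)) refl c (a zero) (c ^ k) _)

prodFin-linear-at : (j₀ : Fin k) (a b c : Fin k → ℚ) (t : ℚ) →
  (∀ j → j ≢ j₀ → a j ≡ c j) → (∀ j → j ≢ j₀ → b j ≡ c j) → c j₀ ≡ a j₀ + t * b j₀ →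
  prodFin k c ≡ prodFin k a + t * prodFin k b
prodFin-linear-at zero a b c t a≡c b≡c c₀≡ = begin
  c zero * Π c                       ≡⟨ cong₂ _*_ c₀≡ (prodFin-cong λ j → sym (a≡c (suc j) λ ())) ⟩
  (a zero + t * b zero) * Π a        ≡⟨ solve 4 (λ a₀ t b₀ A → (a₀ :+ t :* b₀) :* A := a₀ :* A :+ t :* (b₀ :* A))
                                                refl (a zero) t (b zero) (Π a) ⟩
  a zero * Π a + t * (b zero * Π a)  ≡⟨ cong (λ r → a zero * Π a + t * (b zero * r))
                                              (prodFin-cong λ j → trans (a≡c (suc j) λ ()) (sym (b≡c (suc j) λ ()))) ⟩
  a zero * Π a + t * (b zero * Π b)  ∎
  where
  open ≡-Reasoning
  Π : (Fin _ → ℚ) → ℚ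
  Π f = prodFin _ (f ∘ suc)
prodFin-linear-at (suc j₀) a b c t a≡c b≡c c₀≡ = begin
  c zero * Π c                       ≡⟨ cong (c zero *_) (prodFin-linear-at j₀ (a ∘ suc) (b ∘ suc) (c ∘ suc) t
                                          (λ j j≢j₀ → a≡c (suc j) (j≢j₀ ∘ suc-injective))
                                          (λ j j≢j₀ → b≡c (suc j) (j≢j₀ ∘ suc-injective)) c₀≡) ⟩
  c zero * (Π a + t * Π b)           ≡⟨ solve 4 (λ c₀ t A B → c₀ :* (A :+ t :* B) := c₀ :* A :+ t :* (c₀ :* B))
                                                refl (c zero) t (Π a) (Π b) ⟩
  c zero * Π a + t * (c zero * Π b)  ≡⟨ cong₂ (λ u v → u * Π a + t * (v * Π b))
                                              (sym (a≡c zero λ ())) (sym (b≡c zero λ ())) ⟩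
  a zero * Π a + t * (b zero * Π b)  ∎
  where
  open ≡-Reasoning
  Π : (Fin _ → ℚ) → ℚ
  Π f = prodFin _ (f ∘ suc)

erase : Fin n → (Fin n → ℚ) → Fin n → ℚ
erase i₀ F i = if does (i ≟ i₀) then 1ℚ else F i

prodFin-extract : (F : Fin n → ℚ) (i₀ : Fin n) → prodFin n F ≡ F i₀ * prodFin n (erase i₀ F)
prodFin-extract F zero = cong (F zero *_) (sym (*-identityˡ _))
prodFin-extract F (suc i₀) = trans (cong (F zero *_) (prodFin-extract (F ∘ suc) i₀))
  (solve 3 (λ a b c → a :* (b :* c) := b :* (a :* c)) refl (F zero) (F (suc i₀)) _)

prodFin-injection : (σ : Fin m → Fin n) → Injective _≡_ _≡_ σ → (F : Fin n → ℚ) →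
  (∀ i → (∀ t → σ t ≢ i) → F i ≡ 1ℚ) → prodFin n F ≡ prodFin m (F ∘ σ)
prodFin-injection {zero} σ _ F outside = prodFin-ones F λ i → outside i λ ()
prodFin-injection {suc m} {n} σ σ-inj F outside = begin
  prodFin n F                                          ≡⟨ prodFin-extract F (σ zero) ⟩
  F (σ zero) * prodFin n (erase (σ zero) F)            ≡⟨ cong (F (σ zero) *_) (prodFin-injection (σ ∘ suc)
                                                            (suc-injective ∘ σ-inj) (erase (σ zero) F) outside') ⟩
  F (σ zero) * prodFin m (erase (σ zero) F ∘ σ ∘ suc)  ≡⟨ cong (F (σ zero) *_) (prodFin-cong kept) ⟩
  F (σ zero) * prodFin m (F ∘ σ ∘ suc)                 ∎
  where
  open ≡-Reasoning
  outside' : ∀ i → (∀ t → σ (suc t) ≢ i) → erase (σ zero) F i ≡ 1ℚ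
  outside' i missed with i ≟ σ zero
  ... | yes _ = refl
  ... | no i≢σ₀ = outside i λ { zero σ₀≡i → i≢σ₀ (sym σ₀≡i) ; (suc t) → missed t }
  kept : ∀ t → erase (σ zero) F (σ (suc t)) ≡ F (σ (suc t))
  kept t with σ (suc t) ≟ σ zero
  ... | yes σₜ≡σ₀ = contradiction (σ-inj σₜ≡σ₀) λ ()
  ... | no _ = refl

-- allStrs lists pattern lambdas rather than b ∷ x, so without function extensionality a sum over
-- {0,1}^(1+n) can only be split for summands that respect pointwise equality.
Extensional : (BitStr n → ℚ) → Set
Extensional = Congruent _≗_ _≡_

sumL-allStrs-suc : (h : BitStr (suc n) → ℚ) → Extensional h →
  sumL (map h (allStrs (suc n))) ≡ sumL (map (h ∘ (false ∷_)) (allStrs n)) + sumL (map (h ∘ (true ∷_)) (allStrs n))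
sumL-allStrs-suc {n} h h-ext =
  trans (sumL-++ h (map _ (allStrs n)) (map _ (allStrs n)))
        (cong₂ _+_ (half false λ _ → ∷-cong refl λ _ → refl) (half true λ _ → ∷-cong refl λ _ → refl))
  where
  half : ∀ b {c : BitStr n → BitStr (suc n)} → (∀ x → c x ≗ b ∷ x) →
         sumL (map h (map c (allStrs n))) ≡ sumL (map (h ∘ (b ∷_)) (allStrs n))
  half b c≗b∷ = cong sumL (trans (sym (map-∘ (allStrs n))) (map-cong (λ x → h-ext (c≗b∷ x)) (allStrs n)))

ε : BitStr 0
ε ()

sgn : Bool → ℚ
sgn b = if b then - 1ℚ else 1ℚ

avg halfDiff : (BitStr (suc n) → ℚ) → BitStr n → ℚ
avg g x = (g (false ∷ x) + g (true ∷ x)) * ½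
halfDiff g x = (g (false ∷ x) - g (true ∷ x)) * ½

avg-ext : (g : BitStr (suc n) → ℚ) → Extensional g → Extensional (avg g)
avg-ext g g-ext x≗y = cong₂ (λ a b → (a + b) * ½) (g-ext (∷-cong refl x≗y)) (g-ext (∷-cong refl x≗y))

avg-sgn : (g : BitStr (suc n) → ℚ) (A B : BitStr n → ℚ) → (∀ b x → g (b ∷ x) ≡ A x + sgn b * B x) → avg g ≗ A
avg-sgn g A B g≡ x = trans (cong₂ (λ u v → (u + v) * ½) (g≡ false x) (g≡ true x))
  (solve 2 (λ a b → ((a :+ con 1ℚ :* b) :+ (a :+ (:- con 1ℚ) :* b)) :* con ½ := a) refl (A x) (B x))

halfDiff-sgn : (g : BitStr (suc n) → ℚ) (A B : BitStr n → ℚ) → (∀ b x → g (b ∷ x) ≡ A x + sgn b * B x) →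
               halfDiff g ≗ B
halfDiff-sgn g A B g≡ x = trans (cong₂ (λ u v → (u - v) * ½) (g≡ false x) (g≡ true x))
  (solve 2 (λ a b → ((a :+ con 1ℚ :* b) :- (a :+ (:- con 1ℚ) :* b)) :* con ½ := b) refl (A x) (B x))

E-cong : {g h : BitStr n → ℚ} → g ≗ h → E n g ≡ E n h
E-cong {n} g≗h = cong (λ r → sumL r * ½ ^ n) (map-cong g≗h (allStrs n))

E-dim0 : (g : BitStr 0 → ℚ) → Extensional g → E 0 g ≡ g ε
E-dim0 g g-ext = trans (solve 1 (λ a → (a :+ con 0ℚ) :* con 1ℚ := a) refl _) (g-ext λ ())

E-split : (h : BitStr (suc n) → ℚ) → Extensional h → E (suc n) h ≡ E n (avg h)
E-split {n} h h-ext = begin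
  sumL (map h (allStrs (suc n))) * (½ * ½ ^ n)   ≡⟨ cong (_* (½ * ½ ^ n)) (sumL-allStrs-suc h h-ext) ⟩
  (Σ₀ + Σ₁) * (½ * ½ ^ n)                        ≡⟨ sym (*-assoc (Σ₀ + Σ₁) ½ (½ ^ n)) ⟩
  (Σ₀ + Σ₁) * ½ * ½ ^ n                          ≡⟨ cong (λ r → r * ½ * ½ ^ n) (sym (sumL-+ _ _ (allStrs n))) ⟩
  sumL (map (λ x → h (false ∷ x) + h (true ∷ x)) (allStrs n)) * ½ * ½ ^ n
                                                 ≡⟨ cong (_* ½ ^ n) (sym (sumL-*ʳ ½ _ (allStrs n))) ⟩
  sumL (map (avg h) (allStrs n)) * ½ ^ n         ∎
  where
  open ≡-Reasoning
  Σ₀ = sumL (map (h ∘ (false ∷_)) (allStrs n))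
  Σ₁ = sumL (map (h ∘ (true ∷_)) (allStrs n))

chi-cong : {s s' u u' : BitStr n} → s ≗ s' → u ≗ u' → chi s u ≡ chi s' u'
chi-cong {zero} _ _ = refl
chi-cong {suc n} s≗s' u≗u' =
  cong₂ _*_ (cong₂ (λ a b → sgn (a ∧ b)) (s≗s' zero) (u≗u' zero)) (chi-cong (s≗s' ∘ suc) (u≗u' ∘ suc))

card-cong : {s s' : BitStr n} → s ≗ s' → card s ≡ card s'
card-cong {zero} _ = refl
card-cong {suc n} s≗s' = cong₂ (λ a c → (if a then 1 else 0) ℕ.+ c) (s≗s' zero) (card-cong (s≗s' ∘ suc))

isEmptySet-cong : {s s' : BitStr n} → s ≗ s' → isEmptySet s ≡ isEmptySet s'
isEmptySet-cong {zero} _ = refl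
isEmptySet-cong {suc n} s≗s' = cong₂ (λ a e → if a then false else e) (s≗s' zero) (isEmptySet-cong (s≗s' ∘ suc))

fourier-cong : {g h : BitStr n → ℚ} {s s' : BitStr n} → g ≗ h → s ≗ s' → fourier g s ≡ fourier h s'
fourier-cong g≗h s≗s' = E-cong λ u → cong₂ _*_ (g≗h u) (chi-cong s≗s' λ _ → refl)

*-chi-ext : (g : BitStr n → ℚ) → Extensional g → (s : BitStr n) → Extensional (λ u → g u * chi s u)
*-chi-ext g g-ext s u≗u' = cong₂ _*_ (g-ext u≗u') (chi-cong (λ _ → refl) u≗u')

fourier-false∷ : (g : BitStr (suc n) → ℚ) → Extensional g → (s : BitStr n) →
                 fourier g (false ∷ s) ≡ fourier (avg g) s
fourier-false∷ g g-ext s = trans (E-split _ (*-chi-ext g g-ext (false ∷ s))) (E-cong λ x →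
  solve 4 (λ a b χ h → (a :* (con 1ℚ :* χ) :+ b :* (con 1ℚ :* χ)) :* h := (a :+ b) :* h :* χ)
          refl (g (false ∷ x)) (g (true ∷ x)) (chi s x) ½)

fourier-true∷ : (g : BitStr (suc n) → ℚ) → Extensional g → (s : BitStr n) →
                fourier g (true ∷ s) ≡ fourier (halfDiff g) s
fourier-true∷ g g-ext s = trans (E-split _ (*-chi-ext g g-ext (true ∷ s))) (E-cong λ x →
  solve 4 (λ a b χ h → (a :* (con 1ℚ :* χ) :+ b :* ((:- con 1ℚ) :* χ)) :* h := (a :- b) :* h :* χ)
          refl (g (false ∷ x)) (g (true ∷ x)) (chi s x) ½)

fourier-zero : (s : BitStr n) → fourier (λ _ → 0ℚ) s ≡ 0ℚ
fourier-zero {n} s = trans (cong (_* ½ ^ n) (sumL-*ˡ 0ℚ (chi s) (allStrs n)))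
  (solve 2 (λ a b → con 0ℚ :* a :* b := con 0ℚ) refl (sumL (map (chi s) (allStrs n))) (½ ^ n))

Wp : ℚ → (BitStr n → ℚ) → ℚ
Wp {n} p g = sumL (map (λ s → p ^ card s * ∣ fourier g s ∣) (allStrs n))

Wp-cong : (p : ℚ) {g h : BitStr n → ℚ} → g ≗ h → Wp p g ≡ Wp p h
Wp-cong {n} p g≗h =
  cong sumL (map-cong (λ s → cong (λ r → p ^ card s * ∣ r ∣) (fourier-cong g≗h λ _ → refl)) (allStrs n))

Lp-cong : (p : ℚ) {g h : BitStr n → ℚ} → g ≗ h → Lp p g ≡ Lp p h
Lp-cong {n} p g≗h = cong sumL (map-cong (λ s →
  cong (λ r → if isEmptySet s then 0ℚ else p ^ card s * ∣ r ∣) (fourier-cong g≗h λ _ → refl)) (allStrs n))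

Wp-dim0 : (p : ℚ) (g : BitStr 0 → ℚ) → Extensional g → Wp p g ≡ ∣ g ε ∣
Wp-dim0 p g g-ext = trans (solve 1 (λ a → con 1ℚ :* a :+ con 0ℚ := a) refl _)
  (cong ∣_∣ (trans (solve 1 (λ a → (a :* con 1ℚ :+ con 0ℚ) :* con 1ℚ := a) refl _) (g-ext λ ())))

Wp-zero : (p : ℚ) → Wp {n} p (λ _ → 0ℚ) ≡ 0ℚ
Wp-zero {n} p =
  trans (cong sumL (map-cong (λ s → cong (λ r → p ^ card s * ∣ r ∣) (fourier-zero s)) (allStrs n)))
        (trans (sumL-*ʳ 0ℚ (λ s → p ^ card s) (allStrs n)) (*-zeroʳ (sumL (map (λ s → p ^ card s) (allStrs n)))))

sumL-true∷-weights : (p : ℚ) (g : BitStr (suc n) → ℚ) → Extensional g →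
  sumL (map (λ s → p ^ card (true ∷ s) * ∣ fourier g (true ∷ s) ∣) (allStrs n)) ≡ p * Wp p (halfDiff g)
sumL-true∷-weights {n} p g g-ext = trans
  (cong sumL (map-cong (λ s → trans (cong (λ r → p * p ^ card s * ∣ r ∣) (fourier-true∷ g g-ext s))
                                    (*-assoc p (p ^ card s) _))
                       (allStrs n)))
  (sumL-*ˡ p _ (allStrs n))

Wp-split : (p : ℚ) (g : BitStr (suc n) → ℚ) → Extensional g → Wp p g ≡ Wp p (avg g) + p * Wp p (halfDiff g)
Wp-split {n} p g g-ext = trans (sumL-allStrs-suc _ weight-ext) (cong₂ _+_
  (cong sumL (map-cong (λ s → cong (λ r → p ^ card s * ∣ r ∣) (fourier-false∷ g g-ext s)) (allStrs n)))
  (sumL-true∷-weights p g g-ext))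
  where
  weight-ext : Extensional (λ s → p ^ card s * ∣ fourier g s ∣)
  weight-ext s≗s' = cong₂ (λ c r → p ^ c * ∣ r ∣) (card-cong s≗s') (fourier-cong {g = g} (λ _ → refl) s≗s')

Lp-split : (p : ℚ) (g : BitStr (suc n) → ℚ) → Extensional g → Lp p g ≡ Lp p (avg g) + p * Wp p (halfDiff g)
Lp-split {n} p g g-ext = trans (sumL-allStrs-suc _ weight-ext) (cong₂ _+_
  (cong sumL (map-cong (λ s → cong (λ r → if isEmptySet s then 0ℚ else p ^ card s * ∣ r ∣)
                                   (fourier-false∷ g g-ext s))
                       (allStrs n)))
  (sumL-true∷-weights p g g-ext))
  where
  weight-ext : Extensional (λ s → if isEmptySet s then 0ℚ else p ^ card s * ∣ fourier g s ∣)
  weight-ext s≗s' rewrite isEmptySet-cong s≗s' | card-cong s≗s' | fourier-cong {g = g} (λ _ → refl) s≗s' = refl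

Lp+∣E∣≡Wp : (p : ℚ) (g : BitStr n → ℚ) → Extensional g → Lp p g + ∣ E n g ∣ ≡ Wp p g
Lp+∣E∣≡Wp {zero} p g g-ext =
  trans (+-identityˡ ∣ E 0 g ∣) (trans (cong ∣_∣ (E-dim0 g g-ext)) (sym (Wp-dim0 p g g-ext)))
Lp+∣E∣≡Wp {suc n} p g g-ext = begin
  Lp p g + ∣ E (suc n) g ∣                                ≡⟨ cong₂ (λ l e → l + ∣ e ∣) (Lp-split p g g-ext)
                                                                                    (E-split g g-ext) ⟩
  Lp p (avg g) + p * Wp p (halfDiff g) + ∣ E n (avg g) ∣  ≡⟨ solve 3 (λ l w e → l :+ w :+ e := l :+ e :+ w)
                                                                     refl (Lp p (avg g)) _ _ ⟩
  Lp p (avg g) + ∣ E n (avg g) ∣ + p * Wp p (halfDiff g)  ≡⟨ cong (_+ p * Wp p (halfDiff g))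
                                                                  (Lp+∣E∣≡Wp p (avg g) (avg-ext g g-ext)) ⟩
  Wp p (avg g) + p * Wp p (halfDiff g)                    ≡⟨ sym (Wp-split p g g-ext) ⟩
  Wp p g                                                  ∎
  where open ≡-Reasoning

prodχ : (α β : Fin k → ℚ) → (Fin k → BitStr n) → BitStr n → ℚ
prodχ {k = k} α β S x = prodFin k (λ j → α j + β j * chi (S j) x)

weight : ℚ → (α β : Fin k → ℚ) → (Fin k → BitStr n) → Fin k → ℚ
weight p α β S j = ∣ α j ∣ + ∣ β j ∣ * p ^ card (S j)

PairwiseDisjoint : (Fin k → BitStr n) → Set
PairwiseDisjoint S = ∀ j j' i → S j i ≡ true → S j' i ≡ true → j ≡ j'

Nonempty : BitStr n → Set
Nonempty s = ∃ λ i → s i ≡ true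

prodχ-ext : (α β : Fin k → ℚ) (S : Fin k → BitStr n) → Extensional (prodχ α β S)
prodχ-ext α β S x≗y = prodFin-cong λ j → cong (λ r → α j + β j * r) (chi-cong (λ _ → refl) x≗y)

tail-disjoint : {S : Fin k → BitStr (suc n)} → PairwiseDisjoint S → PairwiseDisjoint (tail ∘ S)
tail-disjoint disjoint j j' i = disjoint j j' (suc i)

tail-nonempty : {s : BitStr (suc n)} → s zero ≡ false → Nonempty s → Nonempty (tail s)
tail-nonempty s₀≡false (zero , s₀≡true) = ⊥-elim (not-¬ s₀≡false s₀≡true)
tail-nonempty s₀≡false (suc i , sᵢ≡true) = i , sᵢ≡true

card-false∷ : (s : BitStr (suc n)) → s zero ≡ false → card s ≡ card (tail s)
card-false∷ s s₀≡false = cong (λ h → (if h then 1 else 0) ℕ.+ card (tail s)) s₀≡false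

card-true∷ : (s : BitStr (suc n)) → s zero ≡ true → card s ≡ suc (card (tail s))
card-true∷ s s₀≡true = cong (λ h → (if h then 1 else 0) ℕ.+ card (tail s)) s₀≡true

chi-false∷ : (s : BitStr (suc n)) → s zero ≡ false → ∀ b x → chi s (b ∷ x) ≡ chi (tail s) x
chi-false∷ s s₀≡false b x = trans (cong (λ h → sgn (h ∧ b) * chi (tail s) x) s₀≡false) (*-identityˡ _)

chi-true∷ : (s : BitStr (suc n)) → s zero ≡ true → ∀ b x → chi s (b ∷ x) ≡ sgn b * chi (tail s) x
chi-true∷ s s₀≡true b x = cong (λ h → sgn (h ∧ b) * chi (tail s) x) s₀≡true

headOwner? : (S : Fin k → BitStr (suc n)) → (∀ j → S j zero ≡ false) ⊎ ∃ λ j₀ → S j₀ zero ≡ true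
headOwner? S with any? (λ j → S j zero ≟ᵇ true)
... | yes owned = inj₂ owned
... | no none = inj₁ λ j → ¬-not λ S₀≡true → none (j , S₀≡true)

module HeadUnowned (α β : Fin k → ℚ) (S : Fin k → BitStr (suc n)) (unowned : ∀ j → S j zero ≡ false) where

  prodχ-∷ : ∀ b x → prodχ α β S (b ∷ x) ≡ prodχ α β (tail ∘ S) x + sgn b * 0ℚ
  prodχ-∷ b x = trans (prodFin-cong λ j → cong (λ r → α j + β j * r) (chi-false∷ (S j) (unowned j) b x))
    (solve 2 (λ g t → g := g :+ t :* con 0ℚ) refl (prodχ α β (tail ∘ S) x) (sgn b))

  avg-prodχ : avg (prodχ α β S) ≗ prodχ α β (tail ∘ S)
  avg-prodχ = avg-sgn (prodχ α β S) (prodχ α β (tail ∘ S)) (λ _ → 0ℚ) prodχ-∷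

  halfDiff-prodχ : halfDiff (prodχ α β S) ≗ λ _ → 0ℚ
  halfDiff-prodχ = halfDiff-sgn (prodχ α β S) (prodχ α β (tail ∘ S)) (λ _ → 0ℚ) prodχ-∷

  weight-tail : (p : ℚ) → prodFin k (weight p α β S) ≡ prodFin k (weight p α β (tail ∘ S))
  weight-tail p = prodFin-cong λ j → cong (λ c → ∣ α j ∣ + ∣ β j ∣ * p ^ c) (card-false∷ (S j) (unowned j))

dropHeadBlock : (Fin k → BitStr (suc n)) → (Fin k → ℚ) → Fin k → ℚ
dropHeadBlock S a j = if S j zero then 0ℚ else a j

module HeadOwner (α β : Fin k → ℚ) (S : Fin k → BitStr (suc n)) (disjoint : PairwiseDisjoint S)
                 {j₀ : Fin k} (owner : S j₀ zero ≡ true) where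

  unowned : ∀ {j} → j ≢ j₀ → S j zero ≡ false
  unowned j≢j₀ = ¬-not λ S₀≡true → j≢j₀ (disjoint _ _ zero S₀≡true owner)

  dropHeadBlock-owner : (a : Fin k → ℚ) → dropHeadBlock S a j₀ ≡ 0ℚ
  dropHeadBlock-owner a = cong (λ h → if h then 0ℚ else a j₀) owner

  dropHeadBlock-unowned : (a : Fin k → ℚ) → ∀ {j} → j ≢ j₀ → dropHeadBlock S a j ≡ a j
  dropHeadBlock-unowned a {j} j≢j₀ = cong (λ h → if h then 0ℚ else a j) (unowned j≢j₀)

  A B : BitStr n → ℚ
  A = prodχ α (dropHeadBlock S β) (tail ∘ S)
  B = prodχ (dropHeadBlock S α) β (tail ∘ S)

  prodχ-∷ : ∀ b x → prodχ α β S (b ∷ x) ≡ A x + sgn b * B x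
  prodχ-∷ b x = prodFin-linear-at j₀ _ _ _ (sgn b)
    (λ j j≢j₀ → cong₂ (λ u v → α j + u * v) (dropHeadBlock-unowned β j≢j₀) (sym (chi-false∷ (S j) (unowned j≢j₀) b x)))
    (λ j j≢j₀ → cong₂ (λ u v → u + β j * v) (dropHeadBlock-unowned α j≢j₀) (sym (chi-false∷ (S j) (unowned j≢j₀) b x)))
    (begin
      α j₀ + β j₀ * chi (S j₀) (b ∷ x)         ≡⟨ cong (λ r → α j₀ + β j₀ * r) (chi-true∷ (S j₀) owner b x) ⟩
      α j₀ + β j₀ * (sgn b * χ)                ≡⟨ solve 4 (λ a c t χ → a :+ c :* (t :* χ)
                                                                  := a :+ con 0ℚ :* χ :+ t :* (con 0ℚ :+ c :* χ))
                                                           refl (α j₀) (β j₀) (sgn b) χ ⟩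
      α j₀ + 0ℚ * χ + sgn b * (0ℚ + β j₀ * χ)  ≡⟨ cong₂ (λ u v → α j₀ + u * χ + sgn b * (v + β j₀ * χ))
                                                        (sym (dropHeadBlock-owner β)) (sym (dropHeadBlock-owner α)) ⟩
      α j₀ + dropHeadBlock S β j₀ * χ + sgn b * (dropHeadBlock S α j₀ + β j₀ * χ) ∎)
    where
    open ≡-Reasoning
    χ = chi (tail (S j₀)) x

  avg-prodχ : avg (prodχ α β S) ≗ A
  avg-prodχ = avg-sgn (prodχ α β S) A B prodχ-∷

  halfDiff-prodχ : halfDiff (prodχ α β S) ≗ B
  halfDiff-prodχ = halfDiff-sgn (prodχ α β S) A B prodχ-∷

  weight-split : (p : ℚ) → prodFin k (weight p α β S)
                         ≡ prodFin k (weight p α (dropHeadBlock S β) (tail ∘ S))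
                           + p * prodFin k (weight p (dropHeadBlock S α) β (tail ∘ S))
  weight-split p = prodFin-linear-at j₀ _ _ _ p
    (λ j j≢j₀ → cong₂ (λ u c → ∣ α j ∣ + ∣ u ∣ * p ^ c) (dropHeadBlock-unowned β j≢j₀)
                                                       (sym (card-false∷ (S j) (unowned j≢j₀))))
    (λ j j≢j₀ → cong₂ (λ u c → ∣ u ∣ + ∣ β j ∣ * p ^ c) (dropHeadBlock-unowned α j≢j₀)
                                                       (sym (card-false∷ (S j) (unowned j≢j₀))))
    (begin
      ∣ α j₀ ∣ + ∣ β j₀ ∣ * p ^ card (S j₀)          ≡⟨ cong (λ c → ∣ α j₀ ∣ + ∣ β j₀ ∣ * p ^ c)
                                                              (card-true∷ (S j₀) owner) ⟩
      ∣ α j₀ ∣ + ∣ β j₀ ∣ * (p * pᶜ)                 ≡⟨ solve 4 (λ a c p q → a :+ c :* (p :* q)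
                                                                        := a :+ con 0ℚ :* q :+ p :* (con 0ℚ :+ c :* q))
                                                                 refl ∣ α j₀ ∣ ∣ β j₀ ∣ p pᶜ ⟩
      ∣ α j₀ ∣ + 0ℚ * pᶜ + p * (0ℚ + ∣ β j₀ ∣ * pᶜ)  ≡⟨ cong₂ (λ u v → ∣ α j₀ ∣ + ∣ u ∣ * pᶜ + p * (∣ v ∣ + ∣ β j₀ ∣ * pᶜ))
                                                              (sym (dropHeadBlock-owner β)) (sym (dropHeadBlock-owner α)) ⟩
      ∣ α j₀ ∣ + ∣ dropHeadBlock S β j₀ ∣ * pᶜ
        + p * (∣ dropHeadBlock S α j₀ ∣ + ∣ β j₀ ∣ * pᶜ)  ∎)
    where
    open ≡-Reasoning
    pᶜ = p ^ card (tail (S j₀))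

  tail-support : (∀ j → β j ≡ 0ℚ ⊎ Nonempty (S j)) → ∀ j → dropHeadBlock S β j ≡ 0ℚ ⊎ Nonempty (tail (S j))
  tail-support support j with S j zero in S₀≡
  ... | true = inj₁ refl
  ... | false = Sum.map₂ (tail-nonempty S₀≡) (support j)

Wp-prodχ-≤ : {p : ℚ} → 0ℚ ≤ p → (α β : Fin k → ℚ) (S : Fin k → BitStr n) → PairwiseDisjoint S →
             Wp p (prodχ α β S) ≤ prodFin k (weight p α β S)
Wp-prodχ-≤ {n = zero} {p} 0≤p α β S _ = begin
  Wp p (prodχ α β S)          ≡⟨ Wp-dim0 p _ (prodχ-ext α β S) ⟩
  ∣ prodχ α β S ε ∣           ≤⟨ ∣prodFin∣≤prodFin _ _ (λ j → ≤-trans (∣p+q∣≤∣p∣+∣q∣ (α j) _)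
                                   (≤-reflexive (cong (λ r → ∣ α j ∣ + r) (∣p*q∣≡∣p∣*∣q∣ (β j) 1ℚ)))) ⟩
  prodFin _ (weight p α β S)  ∎
  where open ≤-Reasoning
Wp-prodχ-≤ {n = suc n} {p} 0≤p α β S disjoint with headOwner? S
... | inj₁ unowned = begin
  Wp p G                                       ≡⟨ Wp-split p G (prodχ-ext α β S) ⟩
  Wp p (avg G) + p * Wp p (halfDiff G)         ≡⟨ cong₂ (λ u v → u + p * v) (Wp-cong p avg-prodχ)
                                                        (trans (Wp-cong p halfDiff-prodχ) (Wp-zero {n} p)) ⟩
  Wp p (prodχ α β (tail ∘ S)) + p * 0ℚ         ≡⟨ solve 2 (λ w p → w :+ p :* con 0ℚ := w) refl _ p ⟩
  Wp p (prodχ α β (tail ∘ S))                  ≤⟨ Wp-prodχ-≤ 0≤p α β (tail ∘ S) (tail-disjoint disjoint) ⟩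
  prodFin _ (weight p α β (tail ∘ S))          ≡⟨ sym (weight-tail p) ⟩
  prodFin _ (weight p α β S)                   ∎
  where
  open ≤-Reasoning
  open HeadUnowned α β S unowned
  G = prodχ α β S
... | inj₂ (j₀ , owner) = begin
  Wp p G                                       ≡⟨ Wp-split p G (prodχ-ext α β S) ⟩
  Wp p (avg G) + p * Wp p (halfDiff G)         ≡⟨ cong₂ (λ u v → u + p * v) (Wp-cong p avg-prodχ)
                                                                              (Wp-cong p halfDiff-prodχ) ⟩
  Wp p A + p * Wp p B                          ≤⟨ +-mono-≤ (Wp-prodχ-≤ 0≤p α (dropHeadBlock S β) (tail ∘ S) disjoint')
                                                    (*-monoˡ-≤-0≤ 0≤p (Wp-prodχ-≤ 0≤p (dropHeadBlock S α) β (tail ∘ S) disjoint')) ⟩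
  prodFin _ (weight p α (dropHeadBlock S β) (tail ∘ S)) + p * prodFin _ (weight p (dropHeadBlock S α) β (tail ∘ S))
                                               ≡⟨ sym (weight-split p) ⟩
  prodFin _ (weight p α β S)                   ∎
  where
  open ≤-Reasoning
  open HeadOwner α β S disjoint owner
  G = prodχ α β S
  disjoint' = tail-disjoint disjoint

E-prodχ : (α β : Fin k → ℚ) (S : Fin k → BitStr n) → PairwiseDisjoint S → (∀ j → β j ≡ 0ℚ ⊎ Nonempty (S j)) →
          E n (prodχ α β S) ≡ prodFin k α
E-prodχ {n = zero} α β S _ support = trans (E-dim0 _ (prodχ-ext α β S)) (prodFin-cong constant)
  where
  constant : ∀ j → α j + β j * 1ℚ ≡ α j
  constant j with support j
  ... | inj₁ β≡0 = trans (cong (λ b → α j + b * 1ℚ) β≡0) (solve 1 (λ a → a :+ con 0ℚ :* con 1ℚ := a) refl (α j))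
  ... | inj₂ (() , _)
E-prodχ {n = suc n} α β S disjoint support with headOwner? S
... | inj₁ unowned = begin
  E (suc n) (prodχ α β S)     ≡⟨ E-split _ (prodχ-ext α β S) ⟩
  E n (avg (prodχ α β S))     ≡⟨ E-cong avg-prodχ ⟩
  E n (prodχ α β (tail ∘ S))  ≡⟨ E-prodχ α β (tail ∘ S) (tail-disjoint disjoint)
                                   (λ j → Sum.map₂ (tail-nonempty (unowned j)) (support j)) ⟩
  prodFin _ α                 ∎
  where
  open ≡-Reasoning
  open HeadUnowned α β S unowned
... | inj₂ (j₀ , owner) = begin
  E (suc n) (prodχ α β S)     ≡⟨ E-split _ (prodχ-ext α β S) ⟩
  E n (avg (prodχ α β S))     ≡⟨ E-cong avg-prodχ ⟩
  E n A                       ≡⟨ E-prodχ α (dropHeadBlock S β) (tail ∘ S) (tail-disjoint disjoint) (tail-support support) ⟩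
  prodFin _ α                 ∎
  where
  open ≡-Reasoning
  open HeadOwner α β S disjoint owner

Lp-prodχ-≤ : {p : ℚ} → 0ℚ ≤ p → (α β : Fin k → ℚ) (S : Fin k → BitStr n) → PairwiseDisjoint S →
  (∀ j → β j ≡ 0ℚ ⊎ Nonempty (S j)) → (∀ j → 0ℚ ≤ α j) → (∀ j → weight p α β S j ≤ (1ℚ + p) * α j) →
  (c : ℚ) → (1ℚ + p) ^ k ≤ 1ℚ + c → Lp p (prodχ α β S) ≤ c * E n (prodχ α β S)
Lp-prodχ-≤ {k = k} {n} {p} 0≤p α β S disjoint support 0≤α weight≤ c pow≤ = +-cancelʳ-≤ (begin
  Lp p G + E n G                    ≡⟨ cong (λ e → Lp p G + e) (sym (0≤p⇒∣p∣≡p 0≤EG)) ⟩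
  Lp p G + ∣ E n G ∣                ≡⟨ Lp+∣E∣≡Wp p G (prodχ-ext α β S) ⟩
  Wp p G                            ≤⟨ Wp-prodχ-≤ 0≤p α β S disjoint ⟩
  prodFin k (weight p α β S)        ≤⟨ prodFin-mono-≤ _ _ 0≤weight weight≤ ⟩
  prodFin k (λ j → (1ℚ + p) * α j)  ≡⟨ trans (prodFin-*ˡ (1ℚ + p) α) (cong ((1ℚ + p) ^ k *_) (sym EG≡Πα)) ⟩
  (1ℚ + p) ^ k * E n G              ≤⟨ *-monoʳ-≤-0≤ 0≤EG pow≤ ⟩
  (1ℚ + c) * E n G                  ≡⟨ solve 2 (λ c e → (con 1ℚ :+ c) :* e := c :* e :+ e) refl c (E n G) ⟩
  c * E n G + E n G                 ∎)
  where
  open ≤-Reasoning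
  G = prodχ α β S
  EG≡Πα : E n G ≡ prodFin k α
  EG≡Πα = E-prodχ α β S disjoint support
  0≤EG : 0ℚ ≤ E n G
  0≤EG = ≤-trans (prodFin-nonNeg α 0≤α) (≤-reflexive (sym EG≡Πα))
  0≤weight : ∀ j → 0ℚ ≤ weight p α β S j
  0≤weight j = 0≤+ (0≤∣p∣ (α j)) (0≤* (0≤∣p∣ (β j)) (0≤^ 0≤p (card (S j))))

infix 8 _·_
_·_ : BitStr n → BitStr n → Bool
_·_ {zero} T y = false
_·_ {suc n} T y = (T zero ∧ y zero) xor (tail T · tail y)

isOne : {w : ℕ} → Fin w → Bool
isOne zero = false
isOne (suc zero) = true
isOne (suc (suc _)) = false

width≤2-affine : (w : ℕ) → w ℕ.≤ 2 → (f : Fin w → Bool) → ∃₂ λ c d → ∀ s → f s ≡ c xor (isOne s ∧ d)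
width≤2-affine zero _ f = false , false , λ ()
width≤2-affine (suc zero) _ f = f zero , false , λ { zero → solveᵇ 1 (λ a → a :=ᵇ a :⊕ conᵇ false) refl (f zero) }
width≤2-affine (suc (suc zero)) _ f = f zero , f zero xor f (suc zero) , λ
  { zero → solveᵇ 1 (λ a → a :=ᵇ a :⊕ conᵇ false) refl (f zero)
  ; (suc zero) → solveᵇ 2 (λ a b → b :=ᵇ a :⊕ (a :⊕ b)) refl (f zero) (f (suc zero)) }
width≤2-affine (suc (suc (suc _))) (s≤s (s≤s ())) f

avgEntryOf : {w w' : ℕ} → (Fin w → Bool → Fin w') → Fin w → Fin w' → ℚ
avgEntryOf tr u v = (b2q (does (tr u false ≟ v)) + b2q (does (tr u true ≟ v))) * ½

-- Column 0 sums to 1 iff exactly two of the four transitions enter vertex 0.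
column-parity : (a b c d : Fin 2) →
  (b2q (does (a ≟ zero)) + b2q (does (b ≟ zero))) * ½ + ((b2q (does (c ≟ zero)) + b2q (does (d ≟ zero))) * ½ + 0ℚ) ≡ 1ℚ →
  isOne d ≡ isOne a xor isOne b xor isOne c
column-parity zero zero zero zero ()
column-parity zero zero zero (suc zero) ()
column-parity zero zero (suc zero) zero ()
column-parity zero zero (suc zero) (suc zero) _ = refl
column-parity zero (suc zero) zero zero ()
column-parity zero (suc zero) zero (suc zero) _ = refl
column-parity zero (suc zero) (suc zero) zero _ = refl
column-parity zero (suc zero) (suc zero) (suc zero) ()
column-parity (suc zero) zero zero zero ()
column-parity (suc zero) zero zero (suc zero) _ = refl
column-parity (suc zero) zero (suc zero) zero _ = refl
column-parity (suc zero) zero (suc zero) (suc zero) ()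
column-parity (suc zero) (suc zero) zero zero _ = refl
column-parity (suc zero) (suc zero) zero (suc zero) ()
column-parity (suc zero) (suc zero) (suc zero) zero ()
column-parity (suc zero) (suc zero) (suc zero) (suc zero) ()

regularLayer-affine : (w w' : ℕ) → w ≡ w' → w ℕ.≤ 2 → (tr : Fin w → Bool → Fin w') →
  (∀ v → sumFin w (λ u → avgEntryOf tr u v) ≡ 1ℚ) →
  ∃₂ λ e d → ∃ λ g → ∀ s b → isOne (tr s b) ≡ e xor (isOne s ∧ d) xor (b ∧ g)
regularLayer-affine zero _ refl _ tr _ = false , false , false , λ ()
regularLayer-affine (suc zero) _ refl _ tr _ = false , false , false , λ { zero b → width1 (tr zero b) b }
  where
  width1 : (v : Fin 1) (b : Bool) → isOne v ≡ b ∧ false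
  width1 zero b = sym (∧-zeroʳ b)
regularLayer-affine (suc (suc zero)) _ refl _ tr columns = e , e xor d , e xor g , λ
  { zero false → solveᵇ 1 (λ e → e :=ᵇ e :⊕ conᵇ false :⊕ conᵇ false) refl e
  ; zero true → solveᵇ 2 (λ e g → g :=ᵇ e :⊕ conᵇ false :⊕ (e :⊕ g)) refl e g
  ; (suc zero) false → solveᵇ 2 (λ e d → d :=ᵇ e :⊕ (e :⊕ d) :⊕ conᵇ false) refl e d
  ; (suc zero) true → trans (column-parity (tr zero false) (tr zero true) (tr (suc zero) false) (tr (suc zero) true) (columns zero))
                            (solveᵇ 3 (λ e g d → e :⊕ g :⊕ d :=ᵇ e :⊕ (e :⊕ d) :⊕ (e :⊕ g)) refl e g d) }
  where
  e = isOne (tr zero false)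
  d = isOne (tr (suc zero) false)
  g = isOne (tr zero true)
regularLayer-affine (suc (suc (suc _))) _ _ (s≤s (s≤s ())) _ _

-- The start vertex is arbitrary: runBP-affine quantifies over it.
dropFirstLayer : BP (suc m) → BP m
dropFirstLayer P = record
  { width = BP.width P ∘ suc
  ; width≤2 = BP.width≤2 P ∘ suc
  ; trans = BP.trans P ∘ suc
  ; start = BP.trans P zero (BP.start P) false
  ; accept = BP.accept P
  }

runBP-affine : (P : BP m) → Regular P →
  ∃₂ λ c d → ∃ λ T → ∀ s y → BP.accept P (runBP m (BP.width P) (BP.trans P) s y) ≡ c xor (isOne s ∧ d) xor T · y
runBP-affine {zero} P _ with width≤2-affine (BP.width P zero) (BP.width≤2 P zero) (BP.accept P)
... | c , d , accept≡ = c , d , (λ ()) , λ s y →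
  trans (accept≡ s) (solveᵇ 2 (λ c a → c :⊕ a :=ᵇ c :⊕ a :⊕ conᵇ false) refl c (isOne s ∧ d))
runBP-affine {suc m} P regular
  with runBP-affine (dropFirstLayer P) (regular ∘ suc)
     | regularLayer-affine (BP.width P zero) (BP.width P (suc zero)) (proj₁ (regular zero)) (BP.width≤2 P zero)
                           (BP.trans P zero) (proj₂ (proj₂ (regular zero)))
... | c , d , T , run≡ | e , d₀ , g , layer≡ = c xor (e ∧ d) , d₀ ∧ d , (g ∧ d) ∷ T , λ s y →
  trans (run≡ (BP.trans P zero s (y zero)) (tail y))
    (trans (cong (λ h → c xor (h ∧ d) xor T · tail y) (layer≡ s (y zero)))
      (solveᵇ 8 (λ c d e d₀ g s b q → c :⊕ ((e :⊕ (s :∧ d₀) :⊕ (b :∧ g)) :∧ d) :⊕ q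
                                   :=ᵇ (c :⊕ (e :∧ d)) :⊕ (s :∧ (d₀ :∧ d)) :⊕ (((g :∧ d) :∧ b) :⊕ q))
              refl c d e d₀ g (isOne s) (y zero) (T · tail y)))

regular-computes-affine : (P : BP m) → Regular P → {f : BitStr m → Bool} → Computes P f →
  ∃₂ λ c T → ∀ y → f y ≡ c xor T · y
regular-computes-affine P regular computes with runBP-affine P regular
... | c , d , T , run≡ = c xor (isOne (BP.start P) ∧ d) , T , λ y →
  trans (sym (computes y)) (trans (run≡ (BP.start P) y) (sym (xor-assoc c _ _)))

sgn-xor : ∀ a b → sgn a * sgn b ≡ sgn (a xor b)
sgn-xor true true = refl
sgn-xor true false = refl
sgn-xor false true = refl
sgn-xor false false = refl

chi≡sgn· : (T y : BitStr n) → chi T y ≡ sgn (T · y)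
chi≡sgn· {zero} T y = refl
chi≡sgn· {suc n} T y =
  trans (cong (sgn (T zero ∧ y zero) *_) (chi≡sgn· (tail T) (tail y))) (sgn-xor (T zero ∧ y zero) (tail T · tail y))

Nonempty? : (T : BitStr m) → Dec (Nonempty T)
Nonempty? T = any? (λ t → T t ≟ᵇ true)

·-empty : (T y : BitStr m) → ¬ Nonempty T → T · y ≡ false
·-empty {zero} T y _ = refl
·-empty {suc m} T y empty rewrite ¬-not (λ T₀≡true → empty (zero , T₀≡true)) =
  ·-empty (tail T) (tail y) λ { (t , Tₜ≡true) → empty (suc t , Tₜ≡true) }

mean amplitude : {T : BitStr m} → Bool → Dec (Nonempty T) → ℚ
mean c (yes _) = ½
mean c (no _) = b2q c
amplitude c (yes _) = - (½ * sgn c)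
amplitude c (no _) = 0ℚ

b2q-affine : (c : Bool) (T y : BitStr m) (T? : Dec (Nonempty T)) →
             b2q (c xor T · y) ≡ mean c T? + amplitude c T? * chi T y
b2q-affine c T y (yes _) = trans (b2q-xor c (T · y)) (cong (λ r → ½ + (- (½ * sgn c)) * r) (sym (chi≡sgn· T y)))
  where
  b2q-xor : ∀ c q → b2q (c xor q) ≡ ½ + (- (½ * sgn c)) * sgn q
  b2q-xor true true = refl
  b2q-xor true false = refl
  b2q-xor false true = refl
  b2q-xor false false = refl
b2q-affine c T y (no empty) = begin
  b2q (c xor T · y)     ≡⟨ cong (λ q → b2q (c xor q)) (·-empty T y empty) ⟩
  b2q (c xor false)     ≡⟨ cong b2q (xor-identityʳ c) ⟩
  b2q c                 ≡⟨ solve 2 (λ a χ → a := a :+ con 0ℚ :* χ) refl (b2q c) (chi T y) ⟩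
  b2q c + 0ℚ * chi T y  ∎
  where open ≡-Reasoning

mean-nonNeg : (c : Bool) {T : BitStr m} (T? : Dec (Nonempty T)) → 0ℚ ≤ mean c T?
mean-nonNeg c (yes _) = nonNegative⁻¹ ½
mean-nonNeg true (no _) = nonNegative⁻¹ 1ℚ
mean-nonNeg false (no _) = ≤-refl

weight-≤-mean : {p : ℚ} → 0ℚ ≤ p → p ≤ 1ℚ → (c : Bool) {T : BitStr m} (T? : Dec (Nonempty T)) (M : ℕ) →
  (Nonempty T → 1 ℕ.≤ M) → ∣ mean c T? ∣ + ∣ amplitude c T? ∣ * p ^ M ≤ (1ℚ + p) * mean c T?
weight-≤-mean {p = p} 0≤p p≤1 c (yes nonempty) M 1≤M with 1≤M nonempty
... | s≤s {n = M'} z≤n = begin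
  ½ + ∣ - (½ * sgn c) ∣ * (p * p ^ M')  ≡⟨ cong (λ r → ½ + r * (p * p ^ M')) (∣½sgn∣ c) ⟩
  ½ + ½ * (p * p ^ M')                 ≤⟨ +-monoʳ-≤ ½ (*-monoˡ-≤-0≤ (nonNegative⁻¹ ½) p*pᴹ'≤p) ⟩
  ½ + ½ * p                            ≡⟨ solve 1 (λ p → con ½ :+ con ½ :* p := (con 1ℚ :+ p) :* con ½) refl p ⟩
  (1ℚ + p) * ½                         ∎
  where
  open ≤-Reasoning
  ∣½sgn∣ : ∀ c → ∣ - (½ * sgn c) ∣ ≡ ½
  ∣½sgn∣ true = refl
  ∣½sgn∣ false = refl
  p*pᴹ'≤p : p * p ^ M' ≤ p
  p*pᴹ'≤p = ≤-trans (*-monoˡ-≤-0≤ 0≤p (p^m≤1 0≤p p≤1 M')) (≤-reflexive (*-identityʳ p))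
weight-≤-mean {p = p} _ _ false (no _) M _ =
  ≤-reflexive (solve 2 (λ x p → con 0ℚ :+ con 0ℚ :* x := (con 1ℚ :+ p) :* con 0ℚ) refl (p ^ M) p)
weight-≤-mean {p = p} 0≤p _ true (no _) M _ = begin
  1ℚ + 0ℚ * p ^ M  ≡⟨ solve 1 (λ x → con 1ℚ :+ con 0ℚ :* x := con 1ℚ) refl (p ^ M) ⟩
  1ℚ               ≤⟨ p≤p+q 1ℚ 0≤p ⟩
  1ℚ + p           ≡⟨ sym (*-identityʳ (1ℚ + p)) ⟩
  (1ℚ + p) * 1ℚ    ∎
  where open ≤-Reasoning

chi≡prodFin : (s u : BitStr n) → chi s u ≡ prodFin n (λ i → sgn (s i ∧ u i))
chi≡prodFin {zero} s u = refl
chi≡prodFin {suc n} s u = cong (sgn (s zero ∧ u zero) *_) (chi≡prodFin (tail s) (tail u))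

card-nonempty : (s : BitStr n) → Nonempty s → 1 ℕ.≤ card s
card-nonempty s (zero , s₀≡true) rewrite s₀≡true = s≤s z≤n
card-nonempty s (suc i , sᵢ≡true) with s zero
... | true = s≤s z≤n
... | false = card-nonempty (tail s) (i , sᵢ≡true)

module Lift {n k : ℕ} (π : Partition n k) where
  open Partition π

  locate : Fin n → Σ (Fin k) (Fin ∘ size)
  locate i = proj₁ (Bijection.strictlySurjective bij i)

  locate-σ : ∀ j t → locate (σ j t) ≡ (j , t)
  locate-σ j t = Bijection.injective bij (trans (proj₂ (Bijection.strictlySurjective bij (σ j t))) (sym (bij-is-σ j t)))

  σ-injective : ∀ j → Injective _≡_ _≡_ (σ j)
  σ-injective j {t} {t'} σt≡σt'
    with Bijection.injective bij (trans (bij-is-σ j t) (trans σt≡σt' (sym (bij-is-σ j t'))))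
  ... | refl = refl

  select : ((j : Fin k) → BitStr (size j)) → Fin k → Σ (Fin k) (Fin ∘ size) → Bool
  select T j (j' , t) with j ≟ j'
  ... | yes refl = T j t
  ... | no _ = false

  select-true : ∀ T j b → select T j b ≡ true → ∃ λ t → b ≡ (j , t)
  select-true T j (j' , t) _ with j ≟ j'
  select-true T j (j , t) _ | yes refl = t , refl
  select-true T j (j' , t) () | no _

  lift : ((j : Fin k) → BitStr (size j)) → Fin k → BitStr n
  lift T j i = select T j (locate i)

  lift-σ : ∀ T j t → lift T j (σ j t) ≡ T j t
  lift-σ T j t rewrite locate-σ j t with j ≟ j
  ... | yes refl = refl
  ... | no j≢j = contradiction refl j≢j

  lift-true : ∀ T j i → lift T j i ≡ true → ∃ λ t → σ j t ≡ i
  lift-true T j i lift≡true with select-true T j (locate i) lift≡true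
  ... | t , locate≡ = t , trans (sym (bij-is-σ j t))
                               (trans (cong (Bijection.to bij) (sym locate≡)) (proj₂ (Bijection.strictlySurjective bij i)))

  lift-disjoint : ∀ T → PairwiseDisjoint (lift T)
  lift-disjoint T j j' i lift≡true lift'≡true
    with select-true T j (locate i) lift≡true | select-true T j' (locate i) lift'≡true
  ... | _ , locate≡ | _ , locate≡' = cong proj₁ (trans (sym locate≡) locate≡')

  lift-nonempty : ∀ T j → Nonempty (T j) → Nonempty (lift T j)
  lift-nonempty T j (t , Tₜ≡true) = σ j t , trans (lift-σ T j t) Tₜ≡true

  chi-lift : ∀ T j x → chi (lift T j) x ≡ chi (T j) (restrict j x)
  chi-lift T j x = begin
    chi (lift T j) x
      ≡⟨ chi≡prodFin (lift T j) x ⟩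
    prodFin n (λ i → sgn (lift T j i ∧ x i))
      ≡⟨ prodFin-injection (σ j) (σ-injective j) _ outside ⟩
    prodFin (size j) (λ t → sgn (lift T j (σ j t) ∧ x (σ j t)))
      ≡⟨ prodFin-cong (λ t → cong (λ b → sgn (b ∧ x (σ j t))) (lift-σ T j t)) ⟩
    prodFin (size j) (λ t → sgn (T j t ∧ restrict j x t))
      ≡⟨ sym (chi≡prodFin (T j) (restrict j x)) ⟩
    chi (T j) (restrict j x)
      ∎
    where
    open ≡-Reasoning
    outside : ∀ i → (∀ t → σ j t ≢ i) → sgn (lift T j i ∧ x i) ≡ 1ℚ
    outside i missed with lift T j i in lift≡
    ... | true = contradiction (proj₂ (lift-true T j i lift≡)) (missed (proj₁ (lift-true T j i lift≡)))
    ... | false = refl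

Lp-blockProduct-≤ : (π : Partition n k) (fs : (j : Fin k) → BitStr (Partition.size π j) → Bool) →
  (∀ j → ∃₂ λ c T → ∀ y → fs j y ≡ c xor T · y) →
  {p : ℚ} → 0ℚ ≤ p → p ≤ 1ℚ → (c : ℚ) → (1ℚ + p) ^ k ≤ 1ℚ + c →
  Lp p (blockProduct π fs) ≤ c * E n (blockProduct π fs)
Lp-blockProduct-≤ {n} {k} π fs affine {p} 0≤p p≤1 c pow≤ = begin
  Lp p (blockProduct π fs)     ≡⟨ Lp-cong p f≗G ⟩
  Lp p (prodχ α β S)           ≤⟨ Lp-prodχ-≤ 0≤p α β S (lift-disjoint T) support 0≤α weight≤ c pow≤ ⟩
  c * E n (prodχ α β S)        ≡⟨ cong (c *_) (sym (E-cong f≗G)) ⟩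
  c * E n (blockProduct π fs)  ∎
  where
  open ≤-Reasoning
  open Partition π
  open Lift π
  cⱼ : Fin k → Bool
  cⱼ j = proj₁ (affine j)
  T : (j : Fin k) → BitStr (size j)
  T j = proj₁ (proj₂ (affine j))
  T? : ∀ j → Dec (Nonempty (T j))
  T? j = Nonempty? (T j)
  α β : Fin k → ℚ
  α j = mean (cⱼ j) (T? j)
  β j = amplitude (cⱼ j) (T? j)
  S : Fin k → BitStr n
  S = lift T

  f≗G : blockProduct π fs ≗ prodχ α β S
  f≗G x = prodFin-cong λ j → begin-equality
    b2q (fs j (restrict j x))             ≡⟨ cong b2q (proj₂ (proj₂ (affine j)) (restrict j x)) ⟩
    b2q (cⱼ j xor T j · restrict j x)     ≡⟨ b2q-affine (cⱼ j) (T j) (restrict j x) (T? j) ⟩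
    α j + β j * chi (T j) (restrict j x)  ≡⟨ cong (λ r → α j + β j * r) (sym (chi-lift T j x)) ⟩
    α j + β j * chi (S j) x               ∎

  0≤α : ∀ j → 0ℚ ≤ α j
  0≤α j = mean-nonNeg (cⱼ j) (T? j)

  support : ∀ j → β j ≡ 0ℚ ⊎ Nonempty (S j)
  support j with T? j
  ... | yes nonempty = inj₂ (lift-nonempty T j nonempty)
  ... | no _ = inj₁ refl

  weight≤ : ∀ j → weight p α β S j ≤ (1ℚ + p) * α j
  weight≤ j = weight-≤-mean 0≤p p≤1 (cⱼ j) (T? j) (card (S j)) (card-nonempty (S j) ∘ lift-nonempty T j)

fromℚᵘ-homo-+ : ∀ x y → fromℚᵘ (x ℚᵘ.+ y) ≡ fromℚᵘ x + fromℚᵘ y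
fromℚᵘ-homo-+ x y = toℚᵘ-injective (ℚᵘ.≃-trans (toℚᵘ-fromℚᵘ (x ℚᵘ.+ y))
  (ℚᵘ.≃-sym (ℚᵘ.≃-trans (toℚᵘ-homo-+ (fromℚᵘ x) (fromℚᵘ y)) (ℚᵘ.+-cong (toℚᵘ-fromℚᵘ x) (toℚᵘ-fromℚᵘ y)))))

fromℚᵘ-homo-* : ∀ x y → fromℚᵘ (x ℚᵘ.* y) ≡ fromℚᵘ x * fromℚᵘ y
fromℚᵘ-homo-* x y = toℚᵘ-injective (ℚᵘ.≃-trans (toℚᵘ-fromℚᵘ (x ℚᵘ.* y))
  (ℚᵘ.≃-sym (ℚᵘ.≃-trans (toℚᵘ-homo-* (fromℚᵘ x) (fromℚᵘ y)) (ℚᵘ.*-cong (toℚᵘ-fromℚᵘ x) (toℚᵘ-fromℚᵘ y)))))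

ℕ/1-+ : ∀ a b → (+ (a ℕ.+ b)) / 1 ≡ (+ a) / 1 + (+ b) / 1
ℕ/1-+ a b = trans (fromℚᵘ-cong {mkℚᵘ (+ (a ℕ.+ b)) 0} {mkℚᵘ (+ a) 0 ℚᵘ.+ mkℚᵘ (+ b) 0} (*≡* numerators))
                  (fromℚᵘ-homo-+ (mkℚᵘ (+ a) 0) (mkℚᵘ (+ b) 0))
  where
  numerators : (+ (a ℕ.+ b)) ℤ.* (+ 1 ℤ.* + 1) ≡ ((+ a) ℤ.* (+ 1) ℤ.+ (+ b) ℤ.* (+ 1)) ℤ.* (+ 1)
  numerators = trans (ℤ.*-identityʳ (+ (a ℕ.+ b)))
    (sym (trans (ℤ.*-identityʳ _) (cong₂ ℤ._+_ (ℤ.*-identityʳ (+ a)) (ℤ.*-identityʳ (+ b)))))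

ℕ/1*1/ℕ : ∀ k → (+ suc k) / 1 * ((+ 1) / suc k) ≡ 1ℚ
ℕ/1*1/ℕ k = trans (sym (fromℚᵘ-homo-* (mkℚᵘ (+ suc k) 0) (mkℚᵘ (+ 1) k)))
                  (fromℚᵘ-cong {mkℚᵘ (+ suc k) 0 ℚᵘ.* mkℚᵘ (+ 1) k} {mkℚᵘ (+ 1) 0} (*≡* numerators))
  where
  numerators : ((+ suc k) ℤ.* (+ 1)) ℤ.* (+ 1) ≡ (+ 1) ℤ.* ((+ 1) ℤ.* (+ suc k))
  numerators = trans (ℤ.*-identityʳ _) (trans (ℤ.*-identityʳ (+ suc k))
    (sym (trans (ℤ.*-identityˡ _) (ℤ.*-identityˡ (+ suc k)))))

0≤ℕ/1 : ∀ j → 0ℚ ≤ (+ j) / 1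
0≤ℕ/1 j = nonNegative⁻¹ ((+ j) / 1) {{normalize-nonNeg j 1}}

pow-1+p-≤-quadratic : {p : ℚ} → 0ℚ ≤ p → ∀ j → (+ j) / 1 * p ≤ 1ℚ →
  (1ℚ + p) ^ j ≤ 1ℚ + (+ j) / 1 * p + (+ j) / 1 * p * ((+ j) / 1 * p)
pow-1+p-≤-quadratic {p} _ zero _ =
  ≤-reflexive (solve 1 (λ p → con 1ℚ := con 1ℚ :+ con 0ℚ :* p :+ con 0ℚ :* p :* (con 0ℚ :* p)) refl p)
pow-1+p-≤-quadratic {p} 0≤p (suc j) [1+j]p≤1 = begin
  (1ℚ + p) * (1ℚ + p) ^ j                        ≤⟨ *-monoˡ-≤-0≤ (0≤+ (nonNegative⁻¹ 1ℚ) 0≤p)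
                                                                  (pow-1+p-≤-quadratic 0≤p j a≤1) ⟩
  (1ℚ + p) * (1ℚ + a + a * a)                    ≤⟨ p≤p+q _ (0≤+ (0≤* (0≤* 0≤p 0≤a) 0≤1-a) (0≤* 0≤p 0≤p)) ⟩
  (1ℚ + p) * (1ℚ + a + a * a) + (p * a * (1ℚ - a) + p * p)
      ≡⟨ solve 2 (λ p j → (con 1ℚ :+ p) :* (con 1ℚ :+ j :* p :+ j :* p :* (j :* p))
                            :+ (p :* (j :* p) :* (con 1ℚ :- j :* p) :+ p :* p)
                          := con 1ℚ :+ (con 1ℚ :+ j) :* p :+ (con 1ℚ :+ j) :* p :* ((con 1ℚ :+ j) :* p)) refl p j′ ⟩
  1ℚ + (1ℚ + j′) * p + (1ℚ + j′) * p * ((1ℚ + j′) * p)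
      ≡⟨ cong (λ K → 1ℚ + K * p + K * p * (K * p)) (sym (ℕ/1-+ 1 j)) ⟩
  1ℚ + (+ suc j) / 1 * p + (+ suc j) / 1 * p * ((+ suc j) / 1 * p) ∎
  where
  open ≤-Reasoning
  j′ = (+ j) / 1
  a = j′ * p
  0≤a : 0ℚ ≤ a
  0≤a = 0≤* (0≤ℕ/1 j) 0≤p
  a≤1 : a ≤ 1ℚ
  a≤1 = ≤-trans (p≤p+q a 0≤p)
    (≤-trans (≤-reflexive (trans (solve 2 (λ j p → j :* p :+ p := (con 1ℚ :+ j) :* p) refl j′ p)
                                 (cong (_* p) (sym (ℕ/1-+ 1 j)))))
             [1+j]p≤1)
  0≤1-a : 0ℚ ≤ 1ℚ - a
  0≤1-a = ≤-trans (≤-reflexive (sym (+-inverseʳ a))) (+-monoˡ-≤ (- a) a≤1)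

module _ (k : ℕ) {p : ℚ} (0≤p : 0ℚ ≤ p) (p≤1/k : p ≤ (+ 1) / suc k) where

  kp≤1 : (+ suc k) / 1 * p ≤ 1ℚ
  kp≤1 = ≤-trans (*-monoˡ-≤-0≤ (0≤ℕ/1 (suc k)) p≤1/k) (≤-reflexive (ℕ/1*1/ℕ k))

  p≤1 : p ≤ 1ℚ
  p≤1 = begin
    p                     ≤⟨ p≤p+q p (0≤* (0≤ℕ/1 k) 0≤p) ⟩
    p + (+ k) / 1 * p     ≡⟨ solve 2 (λ p K → p :+ K :* p := (con 1ℚ :+ K) :* p) refl p ((+ k) / 1) ⟩
    (1ℚ + (+ k) / 1) * p  ≡⟨ cong (_* p) (sym (ℕ/1-+ 1 k)) ⟩
    (+ suc k) / 1 * p     ≤⟨ kp≤1 ⟩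
    1ℚ                    ∎
    where open ≤-Reasoning

  pow-1+p-≤-1+2kp : (1ℚ + p) ^ suc k ≤ 1ℚ + (+ (2 ℕ.* suc k)) / 1 * p
  pow-1+p-≤-1+2kp = begin
    (1ℚ + p) ^ suc k                ≤⟨ pow-1+p-≤-quadratic 0≤p (suc k) kp≤1 ⟩
    1ℚ + a + a * a                  ≤⟨ +-monoʳ-≤ (1ℚ + a) (≤-trans (*-monoˡ-≤-0≤ (0≤* (0≤ℕ/1 (suc k)) 0≤p) kp≤1)
                                                                   (≤-reflexive (*-identityʳ a))) ⟩
    1ℚ + a + a                      ≡⟨ solve 2 (λ K p → con 1ℚ :+ K :* p :+ K :* p := con 1ℚ :+ (K :+ K) :* p) refl K p ⟩
    1ℚ + (K + K) * p                ≡⟨ cong (λ K₂ → 1ℚ + K₂ * p) (sym (trans (cong (λ m → (+ (suc k ℕ.+ m)) / 1)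
                                                                                  (ℕ.+-identityʳ (suc k)))
                                                                            (ℕ/1-+ (suc k) (suc k)))) ⟩
    1ℚ + (+ (2 ℕ.* suc k)) / 1 * p  ∎
    where
    open ≤-Reasoning
    K = (+ suc k) / 1
    a = K * p

lemma3p16 : (n k : ℕ) → .{{_ : NonZero k}} →
    (π : Partition n k) →
    (fs : (j : Fin k) → BitStr (Partition.size π j) → Bool) →
    (∀ j → Σ (BP (Partition.size π j)) (λ P → Regular P × Computes P (fs j))) →
    (p : ℚ) → 0ℚ ≤ p → p ≤ (+ 1) / k →
    Lp p (blockProduct π fs) ≤ ((+ (2 Data.Nat.* k)) / 1) * p * E n (blockProduct π fs)
lemma3p16 n zero {{k≢0}} _ _ _ _ _ _ = ⊥-elim-irr (NonZero.nonZero k≢0)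
lemma3p16 n (suc k) π fs programs p 0≤p p≤1/k =
  Lp-blockProduct-≤ π fs affine 0≤p (p≤1 k 0≤p p≤1/k)
                    ((+ (2 ℕ.* suc k)) / 1 * p) (pow-1+p-≤-1+2kp k 0≤p p≤1/k)
  where
  affine : ∀ j → ∃₂ λ c T → ∀ y → fs j y ≡ c xor T · y
  affine j = let (P , regular , computes) = programs j in regular-computes-affine P regular computes
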